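{- Let $\phi=\{a_1,\dots,a_n\}$ and let $\sigma\in S_n=\mathrm{Sym}(\phi)$ be written as a product of $r$ disjoint cycles $\sigma=\tau_1\cdots\tau_r$, where $\tau_i$ is a $k_i$-cycle with $k_i\ge2$ and $k_1+\cdots+k_r=n$. Let $d\ge1$, let $x_1,\dots,x_d$ be new points, and let $S_{n+d}=\mathrm{Sym}(\phi\cup\{x_1,\dots,x_d\})$. If $\sigma^{ -1}=\rho_1\cdots\rho_s$ where each $\rho_j$ is a $3$-cycle of $S_{n+d}$ moving at least one of $x_1,\dots,x_d$, then $$\sum_{j=1}^{s}\bigl|\{a\in\phi:\rho_j(a)\neq a\}\bigr|\ \ge\ n+r.$$
   Context: Products are compositions, rightmost applied first. The sum counts, over all factors, the number of elements of $\phi$ appearing in each factor. -}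

module Defs where

open import Data.Nat using (ℕ; zero; suc; _+_)
open import Data.Nat.DivMod using (_%_; m%n<n)
open import Data.Fin using (Fin; zero; suc; toℕ; fromℕ<; _↑ˡ_)
open import Data.Fin.Properties using (_≟_)
open import Data.List using (length; filter)
open import Data.List.Base using (allFin)
open import Data.Product using (Σ; _×_)
open import Function using (id; _∘_)
open import Function.Definitions using (Injective)
open import Relation.Binary.PropositionalEquality using (_≡_; _≢_)
open import Relation.Nullary using (¬?)

next : ∀ {k} → Fin k → Fin k
next {suc k} i = fromℕ< (m%n<n (suc (toℕ i)) (suc k))

IsCycle : ∀ {m} → ℕ → (Fin m → Fin m) → Set
IsCycle {m} k f =
  Σ (Fin k → Fin m) λ c →
    Injective _≡_ _≡_ c
    × (∀ i → f (c i) ≡ c (next i))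
    × (∀ x → (∀ i → c i ≢ x) → f x ≡ x)

prod : ∀ {A : Set} s → (Fin s → (A → A)) → A → A
prod zero    f = id
prod (suc s) f = f zero ∘ prod s (f ∘ suc)

sumFin : ∀ s → (Fin s → ℕ) → ℕ
sumFin zero    f = 0
sumFin (suc s) f = f zero + sumFin s (f ∘ suc)

-- number of a ∈ φ = {0,…,n-1} (embedded in Fin (n + d)) moved by g
movedInφ : ∀ n d → (Fin (n + d) → Fin (n + d)) → ℕ
movedInφ n d g = length (filter (λ a → ¬? (g (a ↑ˡ d) ≟ a ↑ˡ d)) (allFin n))

-- Let m z be the number of factors ρ j moving z, so the sum in the theorem is the sum of m over φ.
-- On the support c 0, …, c (k-1) of a cycle τ i the product of the ρ j sends c (l+1) to c l, so m ≥ 1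
-- there. If m were 1 on the whole support, the index of the unique factor moving c l could only grow
-- from c l to c (l+1); at a maximum it is constant on three consecutive points, so one 3-cycle would
-- consist of support points of τ i, whereas every ρ j moves a new point. Hence each support
-- contributes at least k i + 1, and the supports are disjoint.
module Submission where

open import Data.Nat.Properties
  using (+-assoc; +-comm; +-identityʳ; *-identityʳ; *-zeroʳ; +-mono-≤; +-monoʳ-≤; *-monoʳ-≤;
         m+n≡0⇒m≡0; m+n≡0⇒n≡0; suc-injective; 1+n≢n; 1+n≢0; ≤-antisym; ≰⇒>; n≢0⇒n>0;
         module ≤-Reasoning; +-*-semiring; +-commutativeSemigroup)
open import Algebra.Properties.Semiring.Sum +-*-semiring
  using (sum; sum-syntax; sum-cong-≗; sum-replicate-zero; sum-remove; ∑-comm; *-distribˡ-sum)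
open import Algebra.Properties.CommutativeSemigroup +-commutativeSemigroup
  using (x∙yz≈y∙xz)
open import Data.Empty using (⊥; ⊥-elim)
open import Data.Fin as Fin using (Fin; zero; suc; toℕ; fromℕ; fromℕ<; inject₁; _↑ˡ_; _↑ʳ_; punchIn; punchOut)
open import Data.Fin.Properties as Fin
  using (_≟_; any?; toℕ-fromℕ<; toℕ-injective; toℕ-fromℕ; toℕ-inject₁; toℕ<n; 0≢1+n;
         punchOut-injective; punchIn-punchOut)
open import Data.Fin.Relation.Unary.Top using (view; ‵fromℕ; ‵inject₁)
open import Data.List using (length; filter; tabulate; allFin)
open import Data.List.Membership.Propositional.Properties using (∈-allFin)
import Data.List.Relation.Unary.All as All
open import Data.Nat using (ℕ; zero; suc; _+_; _*_; _%_; _≤_; z≤n; s≤s; s≤s⁻¹; _≤?_)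
open import Data.Nat.DivMod using (m%n<n; n%n≡0; m<n⇒m%n≡m)
open import Data.Product using (∃; ∃-syntax; Σ; _×_; _,_; proj₁; proj₂)
open import Data.Sum using (_⊎_; inj₁; inj₂) renaming (map to ⊎-map)
open import Data.Vec.Functional using (Vector)
open import Function using (_∘_; id)
open import Function.Definitions using (Injective)
open import Relation.Binary.PropositionalEquality using (_≡_; _≢_; refl; sym; trans; cong; subst; module ≡-Reasoning)
open import Relation.Nullary using (Dec; yes; no; ¬_; ¬?; contradiction)
open import Relation.Nullary.Decidable using (decidable-stable)
open import Relation.Unary using (Pred; Decidable)

open import Defs

sumFin≡sum : ∀ n (f : Vector ℕ n) → sumFin n f ≡ sum f
sumFin≡sum zero    f = refl
sumFin≡sum (suc n) f = cong (f zero +_) (sumFin≡sum n (f ∘ suc))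

sum-mono-≤ : ∀ {n} {f g : Vector ℕ n} → (∀ i → f i ≤ g i) → sum f ≤ sum g
sum-mono-≤ {zero}  f≤g = z≤n
sum-mono-≤ {suc n} f≤g = +-mono-≤ (f≤g zero) (sum-mono-≤ (f≤g ∘ suc))

sum-suc : ∀ {n} (f : Vector ℕ n) → ∑[ i < n ] suc (f i) ≡ n + sum f
sum-suc {zero}  f = refl
sum-suc {suc n} f = cong suc (trans (cong (f zero +_) (sum-suc (f ∘ suc))) (x∙yz≈y∙xz (f zero) n _))

sum-↑ : ∀ m {n} (f : Vector ℕ (m + n)) →
        sum f ≡ sum (f ∘ (_↑ˡ n)) + sum (f ∘ (m ↑ʳ_))
sum-↑ zero    f = refl
sum-↑ (suc m) f = trans (cong (f zero +_) (sum-↑ m (f ∘ suc))) (sym (+-assoc (f zero) _ _))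

sum-≡0 : ∀ {n} {f : Vector ℕ n} → sum f ≡ 0 → ∀ i → f i ≡ 0
sum-≡0 {f = f} Σf≡0 zero    = m+n≡0⇒m≡0 (f zero) Σf≡0
sum-≡0 {f = f} Σf≡0 (suc i) = sum-≡0 (m+n≡0⇒n≡0 (f zero) Σf≡0) i

sum-≡1 : ∀ {n} {f : Vector ℕ n} → sum f ≡ 1 →
         ∃[ i ] f i ≡ 1 × (∀ j → j ≢ i → f j ≡ 0)
sum-≡1 {suc n} {f} Σf≡1 with f zero in f₀
... | zero with i , fi≡1 , rest ← sum-≡1 Σf≡1 =
  suc i , fi≡1 , λ { zero _ → f₀ ; (suc j) j≢i → rest j (j≢i ∘ cong suc) }
... | suc zero =
  zero , f₀ , λ { zero 0≢0 → ⊥-elim (0≢0 refl) ; (suc j) _ → sum-≡0 (suc-injective Σf≡1) j }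

sum-zero : ∀ {n} {f : Vector ℕ n} → (∀ i → f i ≡ 0) → sum f ≡ 0
sum-zero {n} f≡0 = trans (sum-cong-≗ f≡0) (sum-replicate-zero n)

sum-≤1 : ∀ {n} {f : Vector ℕ n} → (∀ i → f i ≤ 1) →
         (∀ i j → i ≢ j → f i ≡ 0 ⊎ f j ≡ 0) → sum f ≤ 1
sum-≤1 {zero}          f≤1 disjoint = z≤n
sum-≤1 {suc n} {f} f≤1 disjoint with f zero in f₀
... | zero  = sum-≤1 (f≤1 ∘ suc) λ i j i≢j → disjoint (suc i) (suc j) (i≢j ∘ Fin.suc-injective)
... | suc m = begin
  suc m + sum (f ∘ suc) ≡⟨ cong (suc m +_) (sum-zero rest≡0) ⟩
  suc m + 0             ≡⟨ +-identityʳ (suc m) ⟩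
  suc m                 ≡⟨ f₀ ⟨
  f zero                ≤⟨ f≤1 zero ⟩
  1                     ∎
  where
  open ≤-Reasoning
  rest≡0 : ∀ i → f (suc i) ≡ 0
  rest≡0 i with disjoint zero (suc i) (λ ())
  ... | inj₁ f₀≡0 = ⊥-elim (1+n≢0 (trans (sym f₀) f₀≡0))
  ... | inj₂ fi≡0 = fi≡0

sum-≥-length : ∀ {n} {f : Vector ℕ n} → (∀ i → 1 ≤ f i) → n ≤ sum f
sum-≥-length {zero}  1≤f = z≤n
sum-≥-length {suc n} 1≤f = +-mono-≤ (1≤f zero) (sum-≥-length (1≤f ∘ suc))

sum-≥-suc-length : ∀ {n} {f : Vector ℕ n} → (∀ i → 1 ≤ f i) →
                   ∀ i → 2 ≤ f i → suc n ≤ sum f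
sum-≥-suc-length {suc n} {f} 1≤f i 2≤fi = begin
  2 + n                        ≤⟨ +-mono-≤ 2≤fi (sum-≥-length (1≤f ∘ punchIn i)) ⟩
  f i + sum (f ∘ punchIn i)    ≡⟨ sum-remove f ⟨
  sum f                        ∎
  where open ≤-Reasoning

sum-∘-injective : ∀ {m n} {f : Fin m → Fin n} → Injective _≡_ _≡_ f →
                  (w : Vector ℕ n) → sum (w ∘ f) ≤ sum w
sum-∘-injective {zero}          f-inj w = z≤n
sum-∘-injective {suc m} {zero}  {f} f-inj w with () ← f zero
sum-∘-injective {suc m} {suc n} {f} f-inj w = begin
  w (f zero) + sum (w ∘ f ∘ suc)
    ≡⟨ cong (w (f zero) +_) (sum-cong-≗ (cong w ∘ punchIn-punchOut ∘ f₀≢)) ⟨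
  w (f zero) + sum (w ∘ punchIn (f zero) ∘ f′)
    ≤⟨ +-monoʳ-≤ (w (f zero)) (sum-∘-injective f′-inj (w ∘ punchIn (f zero))) ⟩
  w (f zero) + sum (w ∘ punchIn (f zero))
    ≡⟨ sum-remove w ⟨
  sum w
    ∎
  where
  open ≤-Reasoning
  f₀≢ : ∀ i → f zero ≢ f (suc i)
  f₀≢ i = (λ ()) ∘ f-inj
  f′ : Fin m → Fin n
  f′ i = punchOut (f₀≢ i)
  f′-inj : Injective _≡_ _≡_ f′
  f′-inj {i} {j} = Fin.suc-injective ∘ f-inj ∘ punchOut-injective (f₀≢ i) (f₀≢ j)

sum-*-disjoint-supports≤ : ∀ {r n} (g : Vector ℕ n) (χ : Fin r → Vector ℕ n) →
                           (∀ i a → χ i a ≤ 1) →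
                           (∀ i j → i ≢ j → ∀ a → χ i a ≡ 0 ⊎ χ j a ≡ 0) →
                           ∑[ i < r ] ∑[ a < n ] (g a * χ i a) ≤ sum g
sum-*-disjoint-supports≤ {r} {n} g χ χ≤1 disjoint = begin
  ∑[ i < r ] ∑[ a < n ] (g a * χ i a)  ≡⟨ ∑-comm (λ i a → g a * χ i a) ⟩
  ∑[ a < n ] ∑[ i < r ] (g a * χ i a)  ≡⟨ sum-cong-≗ (λ a → *-distribˡ-sum (g a) (λ i → χ i a)) ⟨
  ∑[ a < n ] (g a * ∑[ i < r ] χ i a)  ≤⟨ sum-mono-≤ (λ a → *-monoʳ-≤ (g a) (Σχ≤1 a)) ⟩
  ∑[ a < n ] (g a * 1)                 ≡⟨ sum-cong-≗ (*-identityʳ ∘ g) ⟩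
  sum g                                ∎
  where
  open ≤-Reasoning
  Σχ≤1 : ∀ a → ∑[ i < r ] χ i a ≤ 1
  Σχ≤1 a = sum-≤1 (λ i → χ≤1 i a) λ i j i≢j → disjoint i j i≢j a

indicator : ∀ {p} {P : Set p} → Dec P → ℕ
indicator (yes _) = 1
indicator (no _)  = 0

length-filter-tabulate : ∀ {a p} {A : Set a} {P : Pred A p} (P? : Decidable P) {n} (f : Fin n → A) →
                         length (filter P? (tabulate f)) ≡ sum (indicator ∘ P? ∘ f)
length-filter-tabulate P? {zero}  f = refl
length-filter-tabulate P? {suc n} f with P? (f zero)
... | yes _ = cong suc (length-filter-tabulate P? (f ∘ suc))
... | no _  = length-filter-tabulate P? (f ∘ suc)

toℕ-next : ∀ {k} (i : Fin (suc k)) → toℕ (next i) ≡ suc (toℕ i) % suc k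
toℕ-next {k} i = toℕ-fromℕ< (m%n<n (suc (toℕ i)) (suc k))

next-fromℕ : ∀ k → next (fromℕ k) ≡ zero
next-fromℕ k = toℕ-injective (begin
  toℕ (next (fromℕ k))        ≡⟨ toℕ-next (fromℕ k) ⟩
  suc (toℕ (fromℕ k)) % suc k ≡⟨ cong (λ t → suc t % suc k) (toℕ-fromℕ k) ⟩
  suc k % suc k               ≡⟨ n%n≡0 (suc k) ⟩
  0                           ∎)
  where open ≡-Reasoning

next-inject₁ : ∀ {k} (i : Fin k) → next (inject₁ i) ≡ suc i
next-inject₁ {k} i = toℕ-injective (begin
  toℕ (next (inject₁ i))          ≡⟨ toℕ-next (inject₁ i) ⟩
  suc (toℕ (inject₁ i)) % suc k   ≡⟨ cong (λ t → suc t % suc k) (toℕ-inject₁ i) ⟩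
  suc (toℕ i) % suc k             ≡⟨ m<n⇒m%n≡m (s≤s (toℕ<n i)) ⟩
  suc (toℕ i)                     ∎)
  where open ≡-Reasoning

next-surjective : ∀ {k} (i : Fin k) → ∃ λ j → next j ≡ i
next-surjective {suc k} zero    = fromℕ k , next-fromℕ k
next-surjective {suc k} (suc i) = inject₁ i , next-inject₁ i

next≢ : ∀ {k} → 2 ≤ k → (i : Fin k) → next i ≢ i
next≢ {suc zero}    (s≤s ()) _
next≢ {suc (suc k)} _ i with view i
... | ‵fromℕ     = λ eq → 0≢1+n (trans (sym (next-fromℕ (suc k))) eq)
... | ‵inject₁ j = λ eq → 1+n≢n (begin
  suc (toℕ j)             ≡⟨ cong toℕ (next-inject₁ j) ⟨
  toℕ (next (inject₁ j))  ≡⟨ cong toℕ eq ⟩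
  toℕ (inject₁ j)         ≡⟨ toℕ-inject₁ j ⟩
  toℕ j                   ∎)
  where open ≡-Reasoning

Fin3-orbit : ∀ (i j : Fin 3) → j ≡ i ⊎ j ≡ next i ⊎ j ≡ next (next i)
Fin3-orbit zero             zero             = inj₁ refl
Fin3-orbit zero             (suc zero)       = inj₂ (inj₁ refl)
Fin3-orbit zero             (suc (suc zero)) = inj₂ (inj₂ refl)
Fin3-orbit (suc zero)       zero             = inj₂ (inj₂ refl)
Fin3-orbit (suc zero)       (suc zero)       = inj₁ refl
Fin3-orbit (suc zero)       (suc (suc zero)) = inj₂ (inj₁ refl)
Fin3-orbit (suc (suc zero)) zero             = inj₂ (inj₁ refl)
Fin3-orbit (suc (suc zero)) (suc zero)       = inj₂ (inj₂ refl)
Fin3-orbit (suc (suc zero)) (suc (suc zero)) = inj₁ refl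

module _ {A : Set} where

  prod-fixed : ∀ s (ρ : Fin s → A → A) {z} → (∀ j → ρ j z ≡ z) → prod s ρ z ≡ z
  prod-fixed zero    ρ ρz≡z = refl
  prod-fixed (suc s) ρ ρz≡z = trans (cong (ρ zero) (prod-fixed s (ρ ∘ suc) (ρz≡z ∘ suc))) (ρz≡z zero)

  SoleMover : ∀ {s} → (Fin s → A → A) → Fin s → A → Set
  SoleMover ρ j a = ρ j a ≢ a × (∀ j′ → j′ ≢ j → ρ j′ a ≡ a)

  prod-sole-mover : ∀ r (τ : Fin r → A → A) {i z} → SoleMover τ i z →
                    (∀ j → j ≢ i → τ j (τ i z) ≡ τ i z) → prod r τ z ≡ τ i z
  prod-sole-mover (suc r) τ {zero} (_ , others) _ =
    cong (τ zero) (prod-fixed r (τ ∘ suc) λ j → others (suc j) λ ())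
  prod-sole-mover (suc r) τ {suc i} (moved , others) others′ =
    trans (cong (τ zero) (prod-sole-mover r (τ ∘ suc) (moved , λ j j≢i → others (suc j) (j≢i ∘ Fin.suc-injective))
                                                     λ j j≢i → others′ (suc j) (j≢i ∘ Fin.suc-injective)))
          (others′ zero λ ())

  private
    sole-mover-tail : ∀ {s} (ρ : Fin (suc s) → A → A) {j a} →
                      SoleMover ρ (suc j) a → SoleMover (ρ ∘ suc) j a
    sole-mover-tail ρ (moved , others) = moved , λ j′ j′≢j → others (suc j′) (j′≢j ∘ Fin.suc-injective)

  -- The factors act from index s-1 down to 0, so after ρ j has moved a only factors of smaller index act.
  sole-mover-prod : ∀ s (ρ : Fin s → A → A) →
                    (∀ j z → ρ j (ρ j z) ≡ ρ j z → ρ j z ≡ z) →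
                    ∀ {j j′ a} → SoleMover ρ j a → SoleMover ρ j′ (prod s ρ a) →
                    j′ Fin.≤ j × (j′ ≡ j → prod s ρ a ≡ ρ j a)
  sole-mover-prod (suc s) ρ _ {zero} {zero} (_ , others) _ =
    z≤n , λ _ → cong (ρ zero) (prod-fixed s (ρ ∘ suc) λ j → others (suc j) λ ())
  sole-mover-prod (suc s) ρ fixed-preimage {zero} {suc _} {a} (moved , others) (_ , others′) =
    ⊥-elim (moved (fixed-preimage zero a (subst (λ t → ρ zero t ≡ t) Pa≡ρ₀a (others′ zero λ ()))))
    where
    Pa≡ρ₀a : prod (suc s) ρ a ≡ ρ zero a
    Pa≡ρ₀a = cong (ρ zero) (prod-fixed s (ρ ∘ suc) λ j → others (suc j) λ ())
  sole-mover-prod (suc s) ρ _ {suc _} {zero} _ _ = z≤n , λ ()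
  sole-mover-prod (suc s) ρ fixed-preimage {suc j} {suc j′} {a} a-sole Pa-sole =
    let j′≤j , same = sole-mover-prod s (ρ ∘ suc) (fixed-preimage ∘ suc) (sole-mover-tail ρ a-sole)
                        (subst (SoleMover (ρ ∘ suc) j′) Pa≡Qa (sole-mover-tail ρ Pa-sole))
    in s≤s j′≤j , λ j′≡j → trans Pa≡Qa (same (Fin.suc-injective j′≡j))
    where
    Pa≡Qa : prod (suc s) ρ a ≡ prod s (ρ ∘ suc) a
    Pa≡Qa = fixed-preimage zero (prod s (ρ ∘ suc) a) (proj₂ Pa-sole zero λ ())

module _ {N : ℕ} where

  moves : (Fin N → Fin N) → Fin N → ℕ
  moves f z = indicator (¬? (f z ≟ z))

  moves-fixed : ∀ f {z} → f z ≡ z → moves f z ≡ 0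
  moves-fixed f {z} fz≡z with f z ≟ z
  ... | yes _    = refl
  ... | no fz≢z = contradiction fz≡z fz≢z

  moves-moved : ∀ f {z} → f z ≢ z → moves f z ≡ 1
  moves-moved f {z} fz≢z with f z ≟ z
  ... | yes fz≡z = contradiction fz≡z fz≢z
  ... | no _     = refl

  moves≡0⇒fixed : ∀ f {z} → moves f z ≡ 0 → f z ≡ z
  moves≡0⇒fixed f {z} _ with f z ≟ z
  moves≡0⇒fixed f _  | yes fz≡z = fz≡z
  moves≡0⇒fixed f () | no _

  moves≤1 : ∀ f z → moves f z ≤ 1
  moves≤1 f z with f z ≟ z
  ... | yes _ = z≤n
  ... | no _  = s≤s z≤n

  cycle-support : ∀ {k} {f : Fin N → Fin N} {z} (C : IsCycle k f) → f z ≢ z → ∃ λ i → proj₁ C i ≡ z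
  cycle-support {z = z} (c , _ , _ , fixes) fz≢z =
    decidable-stable (any? λ i → c i ≟ z) λ z∉c → fz≢z (fixes z λ i ci≡z → z∉c (i , ci≡z))

  cycle-fixed-preimage : ∀ {k} {f : Fin N → Fin N} {z} → 2 ≤ k → IsCycle k f → f (f z) ≡ f z → f z ≡ z
  cycle-fixed-preimage {f = f} {z} 2≤k C@(c , c-inj , f-c , _) ffz≡fz =
    decidable-stable (f z ≟ z) λ fz≢z → case-on (cycle-support C fz≢z)
    where
    case-on : (∃ λ i → c i ≡ z) → ⊥
    case-on (i , refl) = next≢ 2≤k (next i) (c-inj (begin
      c (next (next i)) ≡⟨ f-c (next i) ⟨
      f (c (next i))    ≡⟨ cong f (f-c i) ⟨
      f (f (c i))       ≡⟨ ffz≡fz ⟩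
      f (c i)           ≡⟨ f-c i ⟩
      c (next i)        ∎))
      where open ≡-Reasoning

  3-cycle-orbit : ∀ {f : Fin N → Fin N} {z w} → IsCycle 3 f → f z ≢ z → f w ≢ w →
                  w ≡ z ⊎ w ≡ f z ⊎ w ≡ f (f z)
  3-cycle-orbit {f} C@(c , _ , f-c , _) fz≢z fw≢w
    with i , refl ← cycle-support C fz≢z | i′ , refl ← cycle-support C fw≢w =
    ⊎-map (cong c) (⊎-map (λ eq → trans (cong c eq) (sym (f-c i)))
                          (λ eq → trans (cong c eq) (sym (trans (cong f (f-c i)) (f-c (next i))))))
          (Fin3-orbit i i′)

  cycle-moves : ∀ {k} {f : Fin N → Fin N} → 2 ≤ k → (C : IsCycle k f) →
                ∀ l → f (proj₁ C l) ≢ proj₁ C l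
  cycle-moves 2≤k (c , c-inj , f-c , _) l fcl≡cl = next≢ 2≤k l (c-inj (trans (sym (f-c l)) fcl≡cl))

Disjoint : ∀ {A : Set} {r} → (Fin r → A → A) → Set
Disjoint {A} τ = ∀ i j → i ≢ j → ∀ (x : A) → τ i x ≡ x ⊎ τ j x ≡ x

moved⇒sole-mover : ∀ {A : Set} {r} {τ : Fin r → A → A} → Disjoint τ →
                   ∀ {i x} → τ i x ≢ x → SoleMover τ i x
moved⇒sole-mover {τ = τ} disjoint {i} {x} τᵢx≢x = τᵢx≢x , fixed
  where
  fixed : ∀ j → j ≢ i → τ j x ≡ x
  fixed j j≢i with disjoint j i j≢i x
  ... | inj₁ τⱼx≡x = τⱼx≡x
  ... | inj₂ τᵢx≡x = contradiction τᵢx≡x τᵢx≢x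

module _ {N s : ℕ} (ρ : Fin s → Fin N → Fin N) where

  open import Data.List.Extrema (Fin.≤-totalOrder s) using (argmax; f[xs]≤f[argmax])

  multiplicity : Fin N → ℕ
  multiplicity z = ∑[ j < s ] moves (ρ j) z

  multiplicity≡0⇒fixed : ∀ {z} → multiplicity z ≡ 0 → prod s ρ z ≡ z
  multiplicity≡0⇒fixed m≡0 = prod-fixed s ρ λ j → moves≡0⇒fixed (ρ j) (sum-≡0 m≡0 j)

  multiplicity≡1⇒sole-mover : ∀ {z} → multiplicity z ≡ 1 → ∃ λ j → SoleMover ρ j z
  multiplicity≡1⇒sole-mover m≡1 with j , mⱼ≡1 , others ← sum-≡1 m≡1 =
    j , (λ ρⱼz≡z → 1+n≢0 (trans (sym mⱼ≡1) (moves-fixed (ρ j) ρⱼz≡z)))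
      , λ j′ j′≢j → moves≡0⇒fixed (ρ j′) (others j′ j′≢j)

  module _ {k} {c : Fin k → Fin N} (c-inj : Injective _≡_ _≡_ c) (2≤k : 2 ≤ k)
           (prod-c : ∀ l → prod s ρ (c (next l)) ≡ c l) where

    cycle-multiplicity≥1 : ∀ l → 1 ≤ multiplicity (c l)
    cycle-multiplicity≥1 l with l′ , refl ← next-surjective l =
      n≢0⇒n>0 λ m≡0 → next≢ 2≤k l′ (c-inj (trans (sym (multiplicity≡0⇒fixed m≡0)) (prod-c l′)))

    private
      fixed-preimage : (∀ j → IsCycle 3 (ρ j)) → ∀ j z → ρ j (ρ j z) ≡ ρ j z → ρ j z ≡ z
      fixed-preimage ρ-3-cycle j z = cycle-fixed-preimage (s≤s (s≤s z≤n)) (ρ-3-cycle j)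

    ¬cycle-multiplicities≡1 : (∀ j → IsCycle 3 (ρ j)) →
                              (∀ j → ∃ λ w → ρ j w ≢ w × ∀ l → c l ≢ w) →
                              ¬ (∀ l → multiplicity (c l) ≡ 1)
    ¬cycle-multiplicities≡1 ρ-3-cycle ρ-escapes all≡1 = w-outside orbit
      where
      J : Fin k → Fin s
      J l = proj₁ (multiplicity≡1⇒sole-mover (all≡1 l))
      J-sole : ∀ l → SoleMover ρ (J l) (c l)
      J-sole l = proj₂ (multiplicity≡1⇒sole-mover (all≡1 l))

      J-order : ∀ l → J l Fin.≤ J (next l) × (J l ≡ J (next l) → ρ (J (next l)) (c (next l)) ≡ c l)
      J-order l =
        let J≤ , same = sole-mover-prod s ρ (fixed-preimage ρ-3-cycle) (J-sole (next l))
                          (subst (SoleMover ρ (J l)) (sym (prod-c l)) (J-sole l))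
        in J≤ , λ J≡ → trans (sym (same J≡)) (prod-c l)

      -- J increases along the cycle, so it is constant on the successors of a maximum.
      l₀ l₁ l₂ : Fin k
      l₀ = argmax J (fromℕ< 2≤k) (allFin k)
      l₁ = next l₀
      l₂ = next l₁
      J≤J₀ : ∀ l → J l Fin.≤ J l₀
      J≤J₀ l = All.lookup (f[xs]≤f[argmax] (fromℕ< 2≤k) (allFin k)) (∈-allFin l)
      J₀≡J₁ : J l₀ ≡ J l₁
      J₀≡J₁ = Fin.≤-antisym (proj₁ (J-order l₀)) (J≤J₀ l₁)
      J₁≡J₂ : J l₁ ≡ J l₂
      J₁≡J₂ = Fin.≤-antisym (proj₁ (J-order l₁)) (subst (J l₂ Fin.≤_) J₀≡J₁ (J≤J₀ l₂))

      R = ρ (J l₂)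
      R-c₂ : R (c l₂) ≡ c l₁
      R-c₂ = proj₂ (J-order l₁) J₁≡J₂
      R-c₁ : R (c l₁) ≡ c l₀
      R-c₁ = subst (λ j → ρ j (c l₁) ≡ c l₀) J₁≡J₂ (proj₂ (J-order l₀) J₀≡J₁)

      w = proj₁ (ρ-escapes (J l₂))
      c≢w : ∀ l → c l ≢ w
      c≢w = proj₂ (proj₂ (ρ-escapes (J l₂)))
      orbit : w ≡ c l₂ ⊎ w ≡ R (c l₂) ⊎ w ≡ R (R (c l₂))
      orbit = 3-cycle-orbit (ρ-3-cycle (J l₂)) (proj₁ (J-sole l₂)) (proj₁ (proj₂ (ρ-escapes (J l₂))))
      w-outside : ¬ (w ≡ c l₂ ⊎ w ≡ R (c l₂) ⊎ w ≡ R (R (c l₂)))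
      w-outside (inj₁ w≡c₂)          = c≢w l₂ (sym w≡c₂)
      w-outside (inj₂ (inj₁ w≡Rc₂))  = c≢w l₁ (sym (trans w≡Rc₂ R-c₂))
      w-outside (inj₂ (inj₂ w≡RRc₂)) = c≢w l₀ (sym (trans w≡RRc₂ (trans (cong R R-c₂) R-c₁)))

    cycle-multiplicity≥2 : (∀ j → IsCycle 3 (ρ j)) →
                           (∀ j → ∃ λ w → ρ j w ≢ w × ∀ l → c l ≢ w) →
                           ∃ λ l → 2 ≤ multiplicity (c l)
    cycle-multiplicity≥2 ρ-3-cycle ρ-escapes =
      decidable-stable (any? λ l → 2 ≤? multiplicity (c l)) λ none →
        ¬cycle-multiplicities≡1 ρ-3-cycle ρ-escapes λ l →
          ≤-antisym (s≤s⁻¹ (≰⇒> (none ∘ (l ,_)))) (cycle-multiplicity≥1 l)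

    cycle-multiplicity-sum : (∀ j → IsCycle 3 (ρ j)) →
                             (∀ j → ∃ λ w → ρ j w ≢ w × ∀ l → c l ≢ w) →
                             suc k ≤ ∑[ l < k ] multiplicity (c l)
    cycle-multiplicity-sum ρ-3-cycle ρ-escapes =
      let l , 2≤mₗ = cycle-multiplicity≥2 ρ-3-cycle ρ-escapes
      in sum-≥-suc-length cycle-multiplicity≥1 l 2≤mₗ

sum-movedInφ : ∀ n d {s} (ρ : Fin s → Fin (n + d) → Fin (n + d)) →
               sumFin s (λ j → movedInφ n d (ρ j)) ≡ ∑[ a < n ] multiplicity ρ (a ↑ˡ d)
sum-movedInφ n d {s} ρ = begin
  sumFin s (λ j → movedInφ n d (ρ j))         ≡⟨ sumFin≡sum s _ ⟩
  ∑[ j < s ] movedInφ n d (ρ j)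
    ≡⟨ sum-cong-≗ (λ j → length-filter-tabulate (λ a → ¬? (ρ j (a ↑ˡ d) ≟ a ↑ˡ d)) id) ⟩
  ∑[ j < s ] ∑[ a < n ] moves (ρ j) (a ↑ˡ d)  ≡⟨ ∑-comm (λ j a → moves (ρ j) (a ↑ˡ d)) ⟩
  ∑[ a < n ] multiplicity ρ (a ↑ˡ d)          ∎
  where open ≡-Reasoning

module _ {n d r s : ℕ} {k : Fin r → ℕ}
         {τ : Fin r → Fin (n + d) → Fin (n + d)} {ρ : Fin s → Fin (n + d) → Fin (n + d)}
         (2≤k : ∀ i → 2 ≤ k i) (τ-cycle : ∀ i → IsCycle (k i) (τ i))
         (τ-fixes-new : ∀ i y → τ i (n ↑ʳ y) ≡ n ↑ʳ y) (τ-disjoint : Disjoint τ)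
         (ρ-3-cycle : ∀ j → IsCycle 3 (ρ j))
         (ρ-moves-new : ∀ j → Σ (Fin d) λ y → ρ j (n ↑ʳ y) ≢ n ↑ʳ y)
         (ρ-inverse : ∀ x → prod s ρ (prod r τ x) ≡ x) where

  cycle-bound : ∀ i → suc (k i) ≤ ∑[ a < n ] (multiplicity ρ (a ↑ˡ d) * moves (τ i) (a ↑ˡ d))
  cycle-bound i = begin
    suc (k i)                          ≤⟨ cycle-multiplicity-sum ρ c-inj (2≤k i) prod-c ρ-3-cycle escapes ⟩
    ∑[ l < k i ] multiplicity ρ (c l)  ≡⟨ sum-cong-≗ weight-c ⟨
    ∑[ l < k i ] weight (c l)          ≤⟨ sum-∘-injective c-inj weight ⟩
    sum weight                         ≡⟨ sum-↑ n weight ⟩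
    sum φ-weight + sum new-weight      ≡⟨ cong (sum φ-weight +_) (sum-zero new-weight≡0) ⟩
    sum φ-weight + 0                   ≡⟨ +-identityʳ _ ⟩
    sum φ-weight                       ∎
    where
    open ≤-Reasoning
    c = proj₁ (τ-cycle i)
    c-inj = proj₁ (proj₂ (τ-cycle i))
    τ-c : ∀ l → τ i (c l) ≡ c (next l)
    τ-c = proj₁ (proj₂ (proj₂ (τ-cycle i)))
    c-moved : ∀ l → τ i (c l) ≢ c l
    c-moved = cycle-moves (2≤k i) (τ-cycle i)

    weight : Fin (n + d) → ℕ
    weight z = multiplicity ρ z * moves (τ i) z
    weight-c : ∀ l → weight (c l) ≡ multiplicity ρ (c l)
    weight-c l rewrite moves-moved (τ i) (c-moved l) = *-identityʳ (multiplicity ρ (c l))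
    φ-weight : Fin n → ℕ
    φ-weight a = weight (a ↑ˡ d)
    new-weight : Fin d → ℕ
    new-weight y = weight (n ↑ʳ y)
    new-weight≡0 : ∀ y → new-weight y ≡ 0
    new-weight≡0 y rewrite moves-fixed (τ i) (τ-fixes-new i y) = *-zeroʳ (multiplicity ρ (n ↑ʳ y))

    σ-c : ∀ l → prod r τ (c l) ≡ c (next l)
    σ-c l = trans (prod-sole-mover r τ (sole l) λ j j≢i →
                     subst (λ z → τ j z ≡ z) (sym (τ-c l)) (proj₂ (sole (next l)) j j≢i))
                  (τ-c l)
      where
      sole : ∀ l → SoleMover τ i (c l)
      sole = moved⇒sole-mover τ-disjoint ∘ c-moved
    prod-c : ∀ l → prod s ρ (c (next l)) ≡ c l
    prod-c l = trans (cong (prod s ρ) (sym (σ-c l))) (ρ-inverse (c l))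
    escapes : ∀ j → ∃ λ w → ρ j w ≢ w × ∀ l → c l ≢ w
    escapes j = let y , ρⱼy≢y = ρ-moves-new j
                in n ↑ʳ y , ρⱼy≢y , λ l cl≡y → c-moved l (subst (λ z → τ i z ≡ z) (sym cl≡y) (τ-fixes-new i y))

mainTheorem11 :
    (n d r s : ℕ) → 1 ≤ d →
    (τ : Fin r → (Fin (n + d) → Fin (n + d))) → (k : Fin r → ℕ) →
    (∀ i → 2 ≤ k i) →
    (∀ i → IsCycle (k i) (τ i)) →
    (∀ i (y : Fin d) → τ i (n ↑ʳ y) ≡ n ↑ʳ y) →
    (∀ i j → i ≢ j → ∀ x → τ i x ≡ x ⊎ τ j x ≡ x) →
    sumFin r k ≡ n →
    (ρ : Fin s → (Fin (n + d) → Fin (n + d))) →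
    (∀ j → IsCycle 3 (ρ j)) →
    (∀ j → Σ (Fin d) λ y → ρ j (n ↑ʳ y) ≢ n ↑ʳ y) →
    (∀ x → prod s ρ (prod r τ x) ≡ x) →
    n + r ≤ sumFin s (λ j → movedInφ n d (ρ j))
mainTheorem11 n d r s _ τ k 2≤k τ-cycle τ-fixes-new τ-disjoint Σk≡n ρ ρ-3-cycle ρ-moves-new ρ-inverse = begin
  n + r                                ≡⟨ +-comm n r ⟩
  r + n                                ≡⟨ cong (r +_) (trans (sym Σk≡n) (sumFin≡sum r k)) ⟩
  r + sum k                            ≡⟨ sum-suc k ⟨
  ∑[ i < r ] suc (k i)
    ≤⟨ sum-mono-≤ (cycle-bound 2≤k τ-cycle τ-fixes-new τ-disjoint ρ-3-cycle ρ-moves-new ρ-inverse) ⟩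
  ∑[ i < r ] ∑[ a < n ] (g a * χ i a)
    ≤⟨ sum-*-disjoint-supports≤ g χ (λ i a → moves≤1 (τ i) (a ↑ˡ d)) χ-disjoint ⟩
  sum g                                ≡⟨ sum-movedInφ n d ρ ⟨
  sumFin s (λ j → movedInφ n d (ρ j))  ∎
  where
  open ≤-Reasoning
  g : Fin n → ℕ
  g a = multiplicity ρ (a ↑ˡ d)
  χ : Fin r → Fin n → ℕ
  χ i a = moves (τ i) (a ↑ˡ d)
  χ-disjoint : ∀ i j → i ≢ j → ∀ a → χ i a ≡ 0 ⊎ χ j a ≡ 0
  χ-disjoint i j i≢j a = ⊎-map (moves-fixed (τ i)) (moves-fixed (τ j)) (τ-disjoint i j i≢j (a ↑ˡ d))
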